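{- There is a one-dimensional SSM layer $l_{\mathrm{prev}}$ that is both time-invariant and diagonal such that for every sequence $x_1\cdots x_k\in\{0,1\}^*$, $l_{\mathrm{prev}}$ maps $x_1\cdots x_k$ to the sequence $z_1\cdots z_k\in\{0,1\}^*$ with $z_i=x_{i-1}$ for $0<i\le k$, where $x_0=0$.
   Context: An SSM layer of dimension $d$ is a tuple $(\mathbf{h}_0,\mathit{gate},\mathit{inc},\phi)$ with $\mathbf{h}_0\in\mathbb{R}^d$, $\mathit{gate}\colon\mathbb{R}^d\to\mathbb{R}^{d\times d}$, $\mathit{inc}\colon\mathbb{R}^d\to\mathbb{R}^d$ and $\phi\colon\mathbb{R}^d\times\mathbb{R}^d\to\mathbb{R}^d$ computed by a feedforward neural network with ReLU activation ($\mathit{relu}(x)=\max(0,x)$; each node computes $\mathit{relu}(\sum_i c_ix_i+b)$). On input $\mathbf{x}_1\cdots\mathbf{x}_k$ it computes $\mathbf{h}_t=\mathit{gate}(\mathbf{x}_t)\mathbf{h}_{t-1}+\mathit{inc}(\mathbf{x}_t)$ for $1\le t\le k$ and outputs $\mathbf{z}_t=\phi(\mathbf{h}_t,\mathbf{x}_t)$. The layer is time-invariant if $\mathit{gate}$ is a constant matrix, and diagonal if $\mathit{gate}(\mathbf{x})$ is a diagonal matrix for every $\mathbf{x}$.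
   Formalization: The layer $l_{\mathrm{prev}}$ is taken over ℚ rather than ℝ: its initial state, network weights and biases are rational, and its inputs and states range over the rationals. -}

module Defs where

open import Data.Nat using (ℕ; zero; suc) renaming (_+_ to _+ℕ_; _*_ to _*ℕ_)
open import Data.Fin using (Fin; combine)
import Data.Fin as Fin
open import Data.Rational using (ℚ; 0ℚ; 1ℚ; _+_; _*_; _⊔_)
open import Data.Bool using (Bool; true; false)
open import Data.List using (List; []; _∷_; map)
open import Data.Vec.Functional using (Vector) renaming (_++_ to _++ᵥ_)
open import Data.Product using (_×_)
open import Relation.Binary.PropositionalEquality using (_≡_; _≢_)

-- Vectors in ℚ^n (ℚ stands in for ℝ)
Vecℚ : ℕ → Set
Vecℚ n = Vector ℚ n

relu : ℚ → ℚ
relu x = x ⊔ 0ℚ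

sumFin : ∀ {n} → (Fin n → ℚ) → ℚ
sumFin {zero}  f = 0ℚ
sumFin {suc n} f = f Fin.zero + sumFin (λ i → f (Fin.suc i))

record Layer (n m : ℕ) : Set where
  constructor mkLayer
  field
    W : Fin m → Fin n → ℚ
    b : Fin m → ℚ

evalLayer : ∀ {n m} → Layer n m → Vecℚ n → Vecℚ m
evalLayer (mkLayer W b) x i = relu (sumFin (λ j → W i j * x j) + b i)

data Net : ℕ → ℕ → Set where
  last : ∀ {n m} → Layer n m → Net n m
  _∷ₙ_ : ∀ {n k m} → Layer n k → Net k m → Net n m

evalNet : ∀ {n m} → Net n m → Vecℚ n → Vecℚ m
evalNet (last L)  x = evalLayer L x
evalNet (L ∷ₙ N) x = evalNet N (evalLayer L x)

-- SSM layer of dimension d: (h0, gate, inc, φ), with gate, inc, φ computed by ReLU networks.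
-- gate outputs d*d numbers, read as a d×d matrix via Fin.combine.
record SSM (d : ℕ) : Set where
  field
    h₀      : Vecℚ d
    gateNet : Net d (d *ℕ d)
    incNet  : Net d d
    φNet    : Net (d +ℕ d) d

module _ {d : ℕ} (L : SSM d) where
  open SSM L

  gate : Vecℚ d → Fin d → Fin d → ℚ
  gate x i j = evalNet gateNet x (combine i j)

  inc : Vecℚ d → Vecℚ d
  inc x = evalNet incNet x

  φ : Vecℚ d → Vecℚ d → Vecℚ d
  φ h x = evalNet φNet (h ++ᵥ x)

  step : Vecℚ d → Vecℚ d → Vecℚ d
  step h x i = sumFin (λ j → gate x i j * h j) + inc x i

  runFrom : Vecℚ d → List (Vecℚ d) → List (Vecℚ d)
  runFrom h []       = []
  runFrom h (x ∷ xs) = let h' = step h x in φ h' x ∷ runFrom h' xs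

  run : List (Vecℚ d) → List (Vecℚ d)
  run = runFrom h₀

  TimeInvariant : Set
  TimeInvariant = ∀ x y i j → gate x i j ≡ gate y i j

  Diagonal : Set
  Diagonal = ∀ x i j → i ≢ j → gate x i j ≡ 0ℚ

bit : Bool → ℚ
bit false = 0ℚ
bit true  = 1ℚ

enc : Bool → Vecℚ 1
enc b _ = bit b

shiftPrev : List Bool → List Bool
shiftPrev xs = go false xs
  where
  go : Bool → List Bool → List Bool
  go p []       = []
  go p (x ∷ xs) = p ∷ go x xs

coord₀ : Vecℚ 1 → ℚ
coord₀ z = z Fin.zero

{-# OPTIONS --safe #-}
-- With gate ¼ and increment x, the state h_t = ¼ h_{t-1} + x_t stays in
-- [x_t, x_t + ⅓]. Hence h_t - x_t = ¼ h_{t-1} is at most 1/12 when x_{t-1} = 0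
-- and at least ¼ when x_{t-1} = 1, and the output network recovers x_{t-1} by
-- clamping 6 (h_t - x_t) - ½ to [0, 1], a difference of two ReLUs.
module Submission where

open import Defs
open import Data.Bool using (Bool; true; false)
open import Data.Empty using (⊥-elim)
open import Data.Fin using (Fin; zero; suc)
open import Data.Integer using (+_)
open import Data.List using (List; []; _∷_; map; drop)
open import Data.Product using (Σ; _×_; _,_)
open import Data.Rational using (ℚ; 0ℚ; 1ℚ; ½; _+_; _-_; _*_; _/_; -_; _≤_; _≤?_)
open import Data.Rational.Properties
open import Data.Rational.Solver using (module +-*-Solver)
open import Relation.Binary.PropositionalEquality
  using (_≡_; refl; sym; trans; cong; cong₂; subst; module ≡-Reasoning)
open import Relation.Nullary.Decidable using (from-yes)

open +-*-Solver using (solve; _:=_; con; _:+_; _:-_; _:*_)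

diagonal-dim1 : (L : SSM 1) → Diagonal L
diagonal-dim1 L x zero zero 0≢0 = ⊥-elim (0≢0 refl)

relu-nonPos : ∀ {a} → a ≤ 0ℚ → relu a ≡ 0ℚ
relu-nonPos = p≤q⇒p⊔q≡q

relu-nonNeg : ∀ {a} → 0ℚ ≤ a → relu a ≡ a
relu-nonNeg = p≥q⇒p⊔q≡p

clamp : ℚ → ℚ
clamp a = relu (relu a - relu (a - 1ℚ))

clamp-nonPos : ∀ {a} → a ≤ 0ℚ → clamp a ≡ 0ℚ
clamp-nonPos {a} a≤0 = cong₂ (λ u v → relu (u - v)) (relu-nonPos a≤0) (relu-nonPos a-1≤0)
  where
  a-1≤0 : a - 1ℚ ≤ 0ℚ
  a-1≤0 = ≤-trans (+-monoˡ-≤ (- 1ℚ) a≤0) (from-yes (0ℚ - 1ℚ ≤? 0ℚ))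

clamp-≥1 : ∀ {a} → 1ℚ ≤ a → clamp a ≡ 1ℚ
clamp-≥1 {a} 1≤a = begin
  relu (relu a - relu (a - 1ℚ))  ≡⟨ cong₂ (λ u v → relu (u - v)) (relu-nonNeg 0≤a) (relu-nonNeg 0≤a-1) ⟩
  relu (a - (a - 1ℚ))            ≡⟨ cong relu (solve 1 (λ a → a :- (a :- con 1ℚ) := con 1ℚ) refl a) ⟩
  1ℚ                             ∎
  where
  open ≡-Reasoning
  0≤a : 0ℚ ≤ a
  0≤a = ≤-trans (from-yes (0ℚ ≤? 1ℚ)) 1≤a
  0≤a-1 : 0ℚ ≤ a - 1ℚ
  0≤a-1 = +-monoˡ-≤ (- 1ℚ) 1≤a

¼ ⅓ 1½ 6ℚ : ℚ
¼ = + 1 / 4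
⅓ = + 1 / 3
1½ = + 3 / 2
6ℚ = + 6 / 1

preactivationWeights : Fin 2 → Fin 2 → ℚ
preactivationWeights _ zero    = 6ℚ
preactivationWeights _ (suc _) = - 6ℚ

preactivationBiases : Fin 2 → ℚ
preactivationBiases zero    = - ½
preactivationBiases (suc _) = - ½ - 1ℚ

differenceWeights : Fin 1 → Fin 2 → ℚ
differenceWeights _ zero    = 1ℚ
differenceWeights _ (suc _) = - 1ℚ

lprev : SSM 1
lprev = record
  { h₀      = λ _ → 0ℚ
  ; gateNet = last (mkLayer (λ _ _ → 0ℚ) (λ _ → ¼))
  ; incNet  = last (mkLayer (λ _ _ → 1ℚ) (λ _ → 0ℚ))
  ; φNet    = mkLayer preactivationWeights preactivationBiases
                ∷ₙ last (mkLayer differenceWeights (λ _ → 0ℚ))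
  }

gate-lprev : ∀ x i j → gate lprev x i j ≡ ¼
gate-lprev x zero zero = cong (λ w → relu ((w + 0ℚ) + ¼)) (*-zeroˡ (x zero))

lprev-timeInvariant : TimeInvariant lprev
lprev-timeInvariant x y i j = trans (gate-lprev x i j) (sym (gate-lprev y i j))

step-lprev : ∀ h b → step lprev h (enc b) zero ≡ ¼ * h zero + bit b
step-lprev h false = cong (_+ 0ℚ) (+-identityʳ (¼ * h zero))
step-lprev h true  = cong (_+ 1ℚ) (+-identityʳ (¼ * h zero))

φ-lprev : ∀ h x → φ lprev h x zero ≡ clamp (6ℚ * (h zero - x zero) - ½)
φ-lprev h x = begin
  relu ((1ℚ * relu (a + - ½) + (- 1ℚ * relu (a + (- ½ - 1ℚ)) + 0ℚ)) + 0ℚ)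
    ≡⟨ cong relu (difference (relu (a + - ½)) (relu (a + (- ½ - 1ℚ)))) ⟩
  relu (relu (a + - ½) - relu (a + (- ½ - 1ℚ)))
    ≡⟨ cong₂ (λ u v → relu (relu u - relu v))
             (a≡ (- ½))
             (trans (a≡ (- ½ - 1ℚ)) (sym (+-assoc (6ℚ * (h zero - x zero)) (- ½) (- 1ℚ)))) ⟩
  clamp (6ℚ * (h zero - x zero) - ½) ∎
  where
  open ≡-Reasoning
  a : ℚ
  a = 6ℚ * h zero + (- 6ℚ * x zero + 0ℚ)
  a≡ : ∀ c → a + c ≡ 6ℚ * (h zero - x zero) + c
  a≡ = solve 3 (λ h x c → (con 6ℚ :* h :+ (con (- 6ℚ) :* x :+ con 0ℚ)) :+ c
                           := con 6ℚ :* (h :- x) :+ c)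
             refl (h zero) (x zero)
  difference : ∀ u v → (1ℚ * u + (- 1ℚ * v + 0ℚ)) + 0ℚ ≡ u - v
  difference = solve 2 (λ u v → (con 1ℚ :* u :+ (con (- 1ℚ) :* v :+ con 0ℚ)) :+ con 0ℚ := u :- v) refl

φ-lprev-after-step : ∀ h b → φ lprev (step lprev h (enc b)) (enc b) zero ≡ clamp (1½ * h zero - ½)
φ-lprev-after-step h b = begin
  φ lprev (step lprev h (enc b)) (enc b) zero        ≡⟨ φ-lprev (step lprev h (enc b)) (enc b) ⟩
  clamp (6ℚ * (step lprev h (enc b) zero - bit b) - ½) ≡⟨ cong (λ s → clamp (6ℚ * (s - bit b) - ½)) (step-lprev h b) ⟩
  clamp (6ℚ * ((¼ * h zero + bit b) - bit b) - ½)      ≡⟨ cong clamp (residue (h zero) (bit b)) ⟩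
  clamp (1½ * h zero - ½)                            ∎
  where
  open ≡-Reasoning
  residue : ∀ y c → 6ℚ * ((¼ * y + c) - c) - ½ ≡ 1½ * y - ½
  residue = solve 2 (λ y c → con 6ℚ :* ((con ¼ :* y :+ c) :- c) :- con ½ := con 1½ :* y :- con ½) refl

Remembers : Bool → ℚ → Set
Remembers p h = bit p ≤ h × h ≤ bit p + ⅓

remembers-bounded : ∀ p {h} → Remembers p h → 0ℚ ≤ h × h ≤ + 4 / 3
remembers-bounded false (0≤h , h≤⅓)   = 0≤h , ≤-trans h≤⅓ (from-yes (⅓ ≤? + 4 / 3))
remembers-bounded true  (1≤h , h≤4/3) = ≤-trans (from-yes (0ℚ ≤? 1ℚ)) 1≤h , h≤4/3

remembers-offset : ∀ b {r} → 0ℚ ≤ r → r ≤ ⅓ → Remembers b (r + bit b)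
remembers-offset b {r} 0≤r r≤⅓ =
  ≤-trans (≤-reflexive (sym (+-identityˡ (bit b)))) (+-monoˡ-≤ (bit b) 0≤r) ,
  ≤-trans (+-monoˡ-≤ (bit b) r≤⅓) (≤-reflexive (+-comm ⅓ (bit b)))

remembers-step : ∀ p b {h} → Remembers p h → Remembers b (¼ * h + bit b)
remembers-step p b r with remembers-bounded p r
... | 0≤h , h≤4/3 = remembers-offset b (*-monoˡ-≤-nonNeg ¼ 0≤h) (*-monoˡ-≤-nonNeg ¼ h≤4/3)

stretch-mono : ∀ {x y} → x ≤ y → 1½ * x - ½ ≤ 1½ * y - ½
stretch-mono x≤y = +-monoˡ-≤ (- ½) (*-monoˡ-≤-nonNeg 1½ x≤y)

clamp-remembered : ∀ p {h} → Remembers p h → clamp (1½ * h - ½) ≡ bit p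
clamp-remembered false (_ , h≤⅓) = clamp-nonPos (≤-trans (stretch-mono h≤⅓) (from-yes (1½ * ⅓ - ½ ≤? 0ℚ)))
clamp-remembered true  (1≤h , _) = clamp-≥1 (≤-trans (from-yes (1ℚ ≤? 1½ * 1ℚ - ½)) (stretch-mono 1≤h))

-- drop 1 (shiftPrev (p ∷ xs)) is xs shifted right with p as the initial previous bit.
runFrom-lprev : ∀ p h xs → Remembers p (h zero) →
  map coord₀ (runFrom lprev h (map enc xs)) ≡ map bit (drop 1 (shiftPrev (p ∷ xs)))
runFrom-lprev p h []       _ = refl
runFrom-lprev p h (x ∷ xs) r = cong₂ _∷_
  (trans (φ-lprev-after-step h x) (clamp-remembered p r))
  (runFrom-lprev x (step lprev h (enc x)) xs
    (subst (Remembers x) (sym (step-lprev h x)) (remembers-step p x r)))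

lemma3 : Σ (SSM 1) (λ l → TimeInvariant l × Diagonal l
           × ((xs : List Bool) → map coord₀ (run l (map enc xs)) ≡ map bit (shiftPrev xs)))
lemma3 = lprev , lprev-timeInvariant , diagonal-dim1 lprev ,
  λ xs → runFrom-lprev false (SSM.h₀ lprev) xs (≤-refl , from-yes (0ℚ ≤? 0ℚ + ⅓))
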